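{- For an arbitrary snark $G$, $\operatorname{rdf}(G)=3$ if and only if $\operatorname{df}(G)=3$.
   Context: Graphs are finite and undirected; parallel edges and loops are permitted. A snark is a $2$-connected cubic graph that does not admit a $3$-edge-colouring (a colouring of edges with three colours such that adjacent edges receive distinct colours). A $3$-array of a cubic graph $G$ is a collection $\{M_1,M_2,M_3\}$ of three (not necessarily distinct) perfect matchings of $G$. An edge is uncovered by the $3$-array if it belongs to none of $M_1,M_2,M_3$. The defect $\operatorname{df}(G)$ is the minimum number of uncovered edges taken over all $3$-arrays of $G$. A $3$-array $\{M_1,M_2,M_3\}$ is regular if $M_1\cap M_2\cap M_3=\emptyset$ (equivalently, no edge belongs to all three matchings). The regular defect $\operatorname{rdf}(G)$ is the minimum number of uncovered edges taken over all regular $3$-arrays of $G$. -}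

module Defs where

open import Data.Nat using (ℕ; zero; suc; _+_; _≤_)
open import Data.Fin using (Fin; zero; suc; _≟_)
open import Data.Bool using (Bool; true; false; if_then_else_; not; _∨_)
open import Data.Product using (Σ; ∃; _×_; _,_; proj₁; proj₂)
open import Data.Sum using (_⊎_)
open import Relation.Nullary using (¬_)
open import Relation.Nullary.Decidable using (⌊_⌋)
open import Relation.Binary.PropositionalEquality using (_≡_; _≢_)

-- A finite undirected multigraph (parallel edges and loops allowed):
-- vertices Fin n, edges Fin m, each edge has two (unordered) endpoints.
record Graph : Set where
  field
    n    : ℕ
    m    : ℕ
    ends : Fin m → Fin n × Fin n

open Graph public

Vertex : Graph → Set
Vertex G = Fin (n G)

Edge : Graph → Set
Edge G = Fin (m G)

sumFin : ∀ {k} → (Fin k → ℕ) → ℕ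
sumFin {zero}  f = 0
sumFin {suc k} f = f zero + sumFin (λ i → f (suc i))

count : ∀ {k} → (Fin k → Bool) → ℕ
count p = sumFin (λ i → if p i then 1 else 0)

-- multiplicity of v as an endpoint of e (a loop at v counts twice)
mult : (G : Graph) → Edge G → Vertex G → ℕ
mult G e v = (if ⌊ proj₁ (ends G e) ≟ v ⌋ then 1 else 0)
           + (if ⌊ proj₂ (ends G e) ≟ v ⌋ then 1 else 0)

EdgeSet : Graph → Set
EdgeSet G = Edge G → Bool

degIn : (G : Graph) → EdgeSet G → Vertex G → ℕ
degIn G S v = sumFin (λ e → if S e then mult G e v else 0)

degree : (G : Graph) → Vertex G → ℕ
degree G = degIn G (λ _ → true)

Cubic : Graph → Set
Cubic G = ∀ v → degree G v ≡ 3

-- a perfect matching: every vertex is incident with exactly one edge of M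
-- (a loop would contribute 2, so loops are automatically excluded)
PerfectMatching : (G : Graph) → EdgeSet G → Set
PerfectMatching G M = ∀ v → degIn G M v ≡ 1

Incident : (G : Graph) → Edge G → Vertex G → Set
Incident G e v = proj₁ (ends G e) ≡ v ⊎ proj₂ (ends G e) ≡ v

Adjacent : (G : Graph) → Vertex G → Vertex G → Set
Adjacent G v w = ∃ λ e → (proj₁ (ends G e) ≡ v × proj₂ (ends G e) ≡ w)
                       ⊎ (proj₁ (ends G e) ≡ w × proj₂ (ends G e) ≡ v)

data WalkIn (G : Graph) (P : Vertex G → Set) : Vertex G → Vertex G → Set where
  here : ∀ {v} → P v → WalkIn G P v v
  step : ∀ {u v w} → P u → Adjacent G u v → WalkIn G P v w → WalkIn G P u w

Connected : Graph → Set
Connected G = ∀ (v w : Vertex G) → WalkIn G (λ _ → Data.Unit.⊤) v w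
  where import Data.Unit

TwoConnected : Graph → Set
TwoConnected G =
  Connected G ×
  (∀ (x v w : Vertex G) → v ≢ x → w ≢ x → WalkIn G (λ u → u ≢ x) v w)

ThreeEdgeColourable : Graph → Set
ThreeEdgeColourable G =
  Σ (Edge G → Fin 3) λ c →
    ∀ e f → e ≢ f → (∃ λ v → Incident G e v × Incident G f v) → c e ≢ c f

Snark : Graph → Set
Snark G = Cubic G × TwoConnected G × ¬ ThreeEdgeColourable G

-- a 3-array: three (not necessarily distinct) perfect matchings
ThreeArray : (G : Graph) → EdgeSet G → EdgeSet G → EdgeSet G → Set
ThreeArray G M₁ M₂ M₃ = PerfectMatching G M₁ × PerfectMatching G M₂ × PerfectMatching G M₃

Regular : (G : Graph) → EdgeSet G → EdgeSet G → EdgeSet G → Set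
Regular G M₁ M₂ M₃ = ∀ e → ¬ (M₁ e ≡ true × M₂ e ≡ true × M₃ e ≡ true)

uncovered : (G : Graph) → EdgeSet G → EdgeSet G → EdgeSet G → ℕ
uncovered G M₁ M₂ M₃ = count (λ e → not (M₁ e ∨ M₂ e ∨ M₃ e))

DefectIs : Graph → ℕ → Set
DefectIs G k =
  (∃ λ M₁ → ∃ λ M₂ → ∃ λ M₃ → ThreeArray G M₁ M₂ M₃ × uncovered G M₁ M₂ M₃ ≡ k) ×
  (∀ M₁ M₂ M₃ → ThreeArray G M₁ M₂ M₃ → k ≤ uncovered G M₁ M₂ M₃)

RegularDefectIs : Graph → ℕ → Set
RegularDefectIs G k =
  (∃ λ M₁ → ∃ λ M₂ → ∃ λ M₃ → ThreeArray G M₁ M₂ M₃ × Regular G M₁ M₂ M₃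
      × uncovered G M₁ M₂ M₃ ≡ k) ×
  (∀ M₁ M₂ M₃ → ThreeArray G M₁ M₂ M₃ → Regular G M₁ M₂ M₃ → k ≤ uncovered G M₁ M₂ M₃)

{-# OPTIONS --safe #-}
-- If an edge e lies in all three perfect matchings of a 3-array, each matching uses e at both
-- (distinct) ends of e, so the four other edge-ends there are uncovered. Hence at least four
-- edges are uncovered, or some uncovered edge is parallel to e and exchanging e for it in one
-- matching uncovers one edge fewer. So a 3-array with at most three uncovered edges that no
-- exchange improves is regular, and exchanging repeatedly from any 3-array reaches a regular one
-- or one with four uncovered edges, whence rdf = 3 implies df ≥ 3. Loops, which would spoil the
-- parallel-edge step, do not occur in a snark.
module Submission where

open import Defs
open import Data.Bool using (Bool; true; false; if_then_else_; not; _∨_)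
open import Data.Bool.Properties using () renaming (_≟_ to _≟ᵇ_)
open import Data.Empty using (⊥; ⊥-elim)
open import Data.Fin using (Fin; zero; suc; _≟_)
open import Data.Fin.Properties using (any?)
open import Data.Nat using (ℕ; zero; suc; _+_; _≤_; _<_; z≤n; s≤s)
open import Data.Nat.Properties hiding (_≟_)
open import Data.Nat.Induction using (<-rec)
open import Algebra.Properties.CommutativeSemigroup +-commutativeSemigroup using (interchange)
open import Data.Product using (∃; _×_; _,_; proj₁; proj₂)
open import Data.Sum using (_⊎_; inj₁; inj₂; reduce)
open import Function using (_∘_)
open import Relation.Nullary using (yes; no)
open import Relation.Nullary.Decidable using (⌊_⌋; _×-dec_; ¬?)
open import Relation.Binary.PropositionalEquality

sum-cong : ∀ {k} {f g : Fin k → ℕ} → (∀ i → f i ≡ g i) → sumFin f ≡ sumFin g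
sum-cong {zero}  f≗g = refl
sum-cong {suc k} f≗g = cong₂ _+_ (f≗g zero) (sum-cong (λ i → f≗g (suc i)))

sum-mono : ∀ {k} {f g : Fin k → ℕ} → (∀ i → f i ≤ g i) → sumFin f ≤ sumFin g
sum-mono {zero}  f≤g = z≤n
sum-mono {suc k} f≤g = +-mono-≤ (f≤g zero) (sum-mono (λ i → f≤g (suc i)))

sum-+ : ∀ {k} (f g : Fin k → ℕ) → sumFin (λ i → f i + g i) ≡ sumFin f + sumFin g
sum-+ {zero}  f g = refl
sum-+ {suc k} f g = trans (cong (f zero + g zero +_) (sum-+ (λ i → f (suc i)) (λ i → g (suc i))))
                          (interchange (f zero) (g zero) _ _)

sum-zero : ∀ {k} → sumFin {k} (λ _ → 0) ≡ 0
sum-zero {zero}  = refl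
sum-zero {suc k} = sum-zero {k}

point : ∀ {k} → Fin k → ℕ → Fin k → ℕ
point i a j = if ⌊ j ≟ i ⌋ then a else 0

sum-point : ∀ {k} (i : Fin k) a → sumFin (point i a) ≡ a
sum-point {suc k} zero    a = trans (cong (a +_) (sum-zero {k})) (+-identityʳ a)
sum-point {suc k} (suc i) a = trans (sum-cong point-suc) (sum-point i a)
  where
  point-suc : ∀ j → point (suc i) a (suc j) ≡ point i a j
  point-suc j with j ≟ i
  ... | yes _ = refl
  ... | no _  = refl

point-self : ∀ {k} (i : Fin k) a → point i a i ≡ a
point-self i a with i ≟ i
... | yes _   = refl
... | no i≢i = ⊥-elim (i≢i refl)

point-other : ∀ {k} {i j : Fin k} a → j ≢ i → point i a j ≡ 0
point-other {i = i} {j} a j≢i with j ≟ i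
... | yes j≡i = ⊥-elim (j≢i j≡i)
... | no _    = refl

sum-+-point : ∀ {k} (f : Fin k → ℕ) i a → sumFin (λ j → f j + point i a j) ≡ sumFin f + a
sum-+-point f i a = trans (sum-+ f (point i a)) (cong (sumFin f +_) (sum-point i a))

erase : ∀ {k} → Fin k → (Fin k → ℕ) → Fin k → ℕ
erase i f j = if ⌊ j ≟ i ⌋ then 0 else f j

erase-other : ∀ {k} {i j : Fin k} (f : Fin k → ℕ) → j ≢ i → erase i f j ≡ f j
erase-other {i = i} {j} f j≢i with j ≟ i
... | yes j≡i = ⊥-elim (j≢i j≡i)
... | no _    = refl

sum-erase : ∀ {k} (f : Fin k → ℕ) i → sumFin f ≡ f i + sumFin (erase i f)
sum-erase f i = begin
  sumFin f                                   ≡⟨ sum-cong split ⟩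
  sumFin (λ j → point i (f i) j + erase i f j) ≡⟨ sum-+ (point i (f i)) (erase i f) ⟩
  sumFin (point i (f i)) + sumFin (erase i f) ≡⟨ cong (_+ sumFin (erase i f)) (sum-point i (f i)) ⟩
  f i + sumFin (erase i f)                   ∎
  where
  open ≡-Reasoning
  split : ∀ j → f j ≡ point i (f i) j + erase i f j
  split j with j ≟ i
  ... | yes refl = sym (+-identityʳ (f j))
  ... | no _     = refl

sum-single : ∀ {k} (f : Fin k → ℕ) i → f i ≤ sumFin f
sum-single f i = ≤-trans (m≤m+n (f i) _) (≤-reflexive (sym (sum-erase f i)))

sum-two : ∀ {k} (f : Fin k → ℕ) {i j} → i ≢ j → f i + f j ≤ sumFin f
sum-two f {i} {j} i≢j = begin
  f i + f j                ≡⟨ cong (f i +_) (sym (erase-other f (i≢j ∘ sym))) ⟩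
  f i + erase i f j        ≤⟨ +-monoʳ-≤ (f i) (sum-single (erase i f) j) ⟩
  f i + sumFin (erase i f) ≡⟨ sum-erase f i ⟨
  sumFin f                 ∎
  where open ≤-Reasoning

sum-three : ∀ {k} (f : Fin k → ℕ) {i j l} → i ≢ j → i ≢ l → j ≢ l → f i + f j + f l ≤ sumFin f
sum-three f {i} {j} {l} i≢j i≢l j≢l = begin
  f i + f j + f l                         ≡⟨ +-assoc (f i) (f j) (f l) ⟩
  f i + (f j + f l)                       ≡⟨ cong₂ (λ x y → f i + (x + y)) (erase-other f (i≢j ∘ sym)) (erase-other f (i≢l ∘ sym)) ⟨
  f i + (erase i f j + erase i f l)       ≤⟨ +-monoʳ-≤ (f i) (sum-two (erase i f) j≢l) ⟩
  f i + sumFin (erase i f)                ≡⟨ sum-erase f i ⟨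
  sumFin f                                ∎
  where open ≤-Reasoning

module _ (G : Graph) where

  end₁ end₂ : Edge G → Vertex G
  end₁ z = proj₁ (ends G z)
  end₂ z = proj₂ (ends G z)

  Joins : Edge G → Vertex G → Vertex G → Set
  Joins z v w = (end₁ z ≡ v × end₂ z ≡ w) ⊎ (end₁ z ≡ w × end₂ z ≡ v)

  Loopless : Set
  Loopless = ∀ z → end₁ z ≢ end₂ z

  mult-ends : ∀ z {p q} x → end₁ z ≡ p → end₂ z ≡ q → mult G z x ≡ point x 1 p + point x 1 q
  mult-ends z x refl refl = refl

  incident⇒mult : ∀ {z x} → Incident G z x → 1 ≤ mult G z x
  incident⇒mult {z} {x} (inj₁ refl) = ≤-trans (≤-reflexive (sym (point-self x 1))) (m≤m+n _ _)
  incident⇒mult {z} {x} (inj₂ refl) = ≤-trans (≤-reflexive (sym (point-self x 1))) (m≤n+m _ _)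

  loop-mult : ∀ {z x} → end₁ z ≡ x → end₂ z ≡ x → mult G z x ≡ 2
  loop-mult {z} {x} p q = trans (mult-ends z x p q) (cong₂ _+_ (point-self x 1) (point-self x 1))

  nonloop-mult : ∀ {z} → end₁ z ≢ end₂ z → mult G z (end₁ z) ≡ 1 × mult G z (end₂ z) ≡ 1
  nonloop-mult {z} z-nonloop =
    cong₂ _+_ (point-self (end₁ z) 1) (point-other 1 (z-nonloop ∘ sym)) ,
    cong₂ _+_ (point-other 1 z-nonloop) (point-self (end₂ z) 1)

  mult≡1⇒joins : ∀ {z a} → mult G z a ≡ 1 → ∃ λ b → b ≢ a × Joins z a b
  mult≡1⇒joins {z} {a} m≡1 with end₁ z ≟ a | end₂ z ≟ a
  mult≡1⇒joins () | yes p | yes q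
  ... | yes p | no q  = end₂ z , q , inj₁ (p , refl)
  ... | no p  | yes q = end₁ z , p , inj₂ (refl , q)
  mult≡1⇒joins () | no p  | no q

  joins⇒incident : ∀ {z a b} → Joins z a b → Incident G z a
  joins⇒incident (inj₁ (p , _)) = inj₁ p
  joins⇒incident (inj₂ (_ , q)) = inj₂ q

  joins-end : ∀ {z a b c t} → Joins z a b → Joins z c t → t ≡ a ⊎ t ≡ b
  joins-end (inj₁ (refl , refl)) (inj₁ (_ , refl)) = inj₂ refl
  joins-end (inj₁ (refl , refl)) (inj₂ (refl , _)) = inj₁ refl
  joins-end (inj₂ (refl , refl)) (inj₁ (_ , refl)) = inj₁ refl
  joins-end (inj₂ (refl , refl)) (inj₂ (refl , _)) = inj₂ refl

  incident-loop-mult : ∀ {z v} → end₁ z ≡ end₂ z → Incident G z v → mult G z v ≡ 2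
  incident-loop-mult loop (inj₁ p) = loop-mult p (trans (sym loop) p)
  incident-loop-mult loop (inj₂ q) = loop-mult (trans loop q) q

  walk-start : ∀ {P : Vertex G → Set} {s w} → WalkIn G P s w → P s
  walk-start (here p)     = p
  walk-start (step p _ _) = p

  walk-trapped : ∀ {a b} → (∀ t → Adjacent G a t → t ≡ a ⊎ t ≡ b) →
                 ∀ {s w} → WalkIn G (λ t → t ≢ b) s w → s ≡ a → w ≡ a
  walk-trapped neighbours (here _) s≡a = s≡a
  walk-trapped neighbours (step _ adj rest) refl with neighbours _ adj
  ... | inj₁ refl = walk-trapped neighbours rest refl
  ... | inj₂ refl = ⊥-elim (walk-start rest refl)

  module _ (cubic : Cubic G) where

    lone-edge : ∀ {y a} → mult G y a ≡ 2 →
                ∃ λ e → mult G e a ≡ 1 × (∀ z → 1 ≤ mult G z a → z ≡ e ⊎ z ≡ y)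
    lone-edge {y} {a} y-loop with any? (λ t → ¬? (t ≟ y) ×-dec (1 ≤? mult G t a))
    ... | no none = ⊥-elim (3≢2 (begin
      3                                        ≡⟨ cubic a ⟨
      sumFin (λ t → mult G t a)                ≡⟨ sum-erase (λ t → mult G t a) y ⟩
      mult G y a + sumFin (erase y (λ t → mult G t a)) ≡⟨ cong₂ _+_ y-loop (trans (sum-cong others-zero) (sum-zero {m G})) ⟩
      2                                        ∎))
      where
      open ≡-Reasoning
      3≢2 : 3 ≢ 2
      3≢2 ()
      others-zero : ∀ t → erase y (λ t → mult G t a) t ≡ 0
      others-zero t with t ≟ y
      ... | yes _   = refl
      ... | no t≢y = n<1⇒n≡0 (≰⇒> (λ 1≤t → none (t , t≢y , 1≤t)))
    ... | yes (e , e≢y , 1≤e) = e , e-once , only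
      where
      e+y≤3 : mult G e a + 2 ≤ 3
      e+y≤3 = subst₂ (λ m n → mult G e a + m ≤ n) y-loop (cubic a) (sum-two (λ t → mult G t a) e≢y)
      e-once : mult G e a ≡ 1
      e-once = ≤-antisym (+-cancelʳ-≤ 2 _ 1 e+y≤3) 1≤e
      only : ∀ z → 1 ≤ mult G z a → z ≡ e ⊎ z ≡ y
      only z 1≤z with z ≟ e | z ≟ y
      ... | yes z≡e | _       = inj₁ z≡e
      ... | no _    | yes z≡y = inj₂ z≡y
      ... | no z≢e  | no z≢y  = ⊥-elim (≤⇒≯ three-ends-≤3 (+-monoʳ-≤ 3 1≤z))
        where
        three-ends-≤3 : 1 + 2 + mult G z a ≤ 3
        three-ends-≤3 = subst₂ (λ m n → m + mult G z a ≤ n) (cong₂ _+_ e-once y-loop) (cubic a)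
                          (sum-three (λ t → mult G t a) e≢y (z≢e ∘ sym) (z≢y ∘ sym))

    loops-apart : ∀ {f g v} → f ≢ g → end₁ f ≡ end₂ f → end₁ g ≡ end₂ g →
                  Incident G f v → Incident G g v → ⊥
    loops-apart {f} {g} {v} f≢g f-loop g-loop f∋v g∋v = ≤⇒≯ four≤3 ≤-refl
      where
      four≤3 : 4 ≤ 3
      four≤3 = subst₂ _≤_ (cong₂ _+_ (incident-loop-mult f-loop f∋v) (incident-loop-mult g-loop g∋v))
                 (cubic v) (sum-two (λ t → mult G t v) f≢g)

    only-loops⇒colourable : ∀ e → (∀ z → z ≢ e → end₁ z ≡ end₂ z) → ThreeEdgeColourable G
    only-loops⇒colourable e loop = colour , proper
      where
      colour : Edge G → Fin 3
      colour z = if ⌊ z ≟ e ⌋ then zero else suc zero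
      proper : ∀ f g → f ≢ g → (∃ λ v → Incident G f v × Incident G g v) → colour f ≢ colour g
      proper f g f≢g (v , f∋v , g∋v) with f ≟ e | g ≟ e
      ... | yes refl | yes refl = ⊥-elim (f≢g refl)
      ... | yes _    | no _     = λ ()
      ... | no _     | yes _    = λ ()
      ... | no f≢e   | no g≢e   = ⊥-elim (loops-apart f≢g (loop f f≢e) (loop g g≢e) f∋v g∋v)

    -- A loop at a leaves a single other edge e = ab at a; since G − b is connected and a has no
    -- neighbour other than a and b, these are the only vertices, so every edge but e is a loop.
    loop⇒colourable : TwoConnected G → ∀ y → end₁ y ≡ end₂ y → ThreeEdgeColourable G
    loop⇒colourable (_ , connected-without) y y-loop
      with lone-edge (loop-mult refl (sym y-loop))
    ... | e , e-once , at-a with mult≡1⇒joins e-once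
    ... | b , b≢a , e-joins = only-loops⇒colourable e others-loops
      where
      a = end₁ y
      y-joins : Joins y a a
      y-joins = inj₁ (refl , sym y-loop)
      neighbours : ∀ t → Adjacent G a t → t ≡ a ⊎ t ≡ b
      neighbours t (z , z-joins) with at-a z (incident⇒mult (joins⇒incident z-joins))
      ... | inj₁ z≡e = joins-end e-joins (subst (λ x → Joins x a t) z≡e z-joins)
      ... | inj₂ z≡y = inj₁ (reduce (joins-end y-joins (subst (λ x → Joins x a t) z≡y z-joins)))
      vertex : ∀ w → w ≡ a ⊎ w ≡ b
      vertex w with w ≟ b
      ... | yes w≡b = inj₂ w≡b
      ... | no w≢b  = inj₁ (walk-trapped neighbours (connected-without b a w (b≢a ∘ sym) w≢b) refl)
      at-a-loop : ∀ {z} → z ≢ e → Incident G z a → end₁ z ≡ end₂ z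
      at-a-loop {z} z≢e z∋a with at-a z (incident⇒mult z∋a)
      ... | inj₁ z≡e = ⊥-elim (z≢e z≡e)
      ... | inj₂ z≡y = subst (λ x → end₁ x ≡ end₂ x) (sym z≡y) y-loop
      others-loops : ∀ z → z ≢ e → end₁ z ≡ end₂ z
      others-loops z z≢e with vertex (end₁ z) | vertex (end₂ z)
      ... | inj₁ p | _      = at-a-loop z≢e (inj₁ p)
      ... | _      | inj₁ q = at-a-loop z≢e (inj₂ q)
      ... | inj₂ p | inj₂ q = trans p (sym q)

  snark-loopless : Snark G → Loopless
  snark-loopless (cubic , connected , uncolourable) y y-loop =
    uncolourable (loop⇒colourable cubic connected y y-loop)

  heavy⇒joins : ∀ {y u v} → end₁ y ≢ end₂ y → u ≢ v → 2 ≤ mult G y u + mult G y v → Joins y u v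
  heavy⇒joins {y} {u} {v} y-nonloop u≢v heavy
    with end₁ y ≟ u | end₂ y ≟ u | end₁ y ≟ v | end₂ y ≟ v
  ... | yes p | _     | yes q | _     = ⊥-elim (u≢v (trans (sym p) q))
  ... | _     | yes p | _     | yes q = ⊥-elim (u≢v (trans (sym p) q))
  ... | yes p | yes q | no _  | no _  = ⊥-elim (y-nonloop (trans p (sym q)))
  ... | no _  | no _  | yes p | yes q = ⊥-elim (y-nonloop (trans p (sym q)))
  ... | yes p | no _  | no _  | yes q = inj₁ (p , q)
  ... | no _  | yes p | yes q | no _  = inj₂ (q , p)
  heavy⇒joins _ _ (s≤s ()) | yes _ | no _ | no _ | no _
  heavy⇒joins _ _ (s≤s ()) | no _ | yes _ | no _ | no _
  heavy⇒joins _ _ (s≤s ()) | no _ | no _ | yes _ | no _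
  heavy⇒joins _ _ (s≤s ()) | no _ | no _ | no _ | yes _
  heavy⇒joins _ _ ()       | no _ | no _ | no _ | no _

  joins-mult : ∀ {y e u v} → Joins y u v → Joins e u v → ∀ x → mult G y x ≡ mult G e x
  joins-mult {y} {e} (inj₁ (p , q)) (inj₁ (p′ , q′)) x = trans (mult-ends y x p q) (sym (mult-ends e x p′ q′))
  joins-mult {y} {e} (inj₂ (p , q)) (inj₂ (p′ , q′)) x = trans (mult-ends y x p q) (sym (mult-ends e x p′ q′))
  joins-mult {y} {e} {u} {v} (inj₁ (p , q)) (inj₂ (p′ , q′)) x =
    trans (mult-ends y x p q) (trans (+-comm (point x 1 u) _) (sym (mult-ends e x p′ q′)))
  joins-mult {y} {e} {u} {v} (inj₂ (p , q)) (inj₁ (p′ , q′)) x =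
    trans (mult-ends y x p q) (trans (+-comm (point x 1 v) _) (sym (mult-ends e x p′ q′)))

  true≢false : true ≢ false
  true≢false ()

  exchange : EdgeSet G → Edge G → Edge G → EdgeSet G
  exchange M e y z = if ⌊ z ≟ e ⌋ then false else if ⌊ z ≟ y ⌋ then true else M z

  exchange-sum : ∀ {M e y} → M e ≡ true → M y ≡ false → ∀ (f : Edge G → ℕ) →
    sumFin (λ z → if exchange M e y z then f z else 0) + f e ≡ sumFin (λ z → if M z then f z else 0) + f y
  exchange-sum {M} {e} {y} Me My f = begin
    sumFin (λ z → if exchange M e y z then f z else 0) + f e    ≡⟨ sum-+-point _ e (f e) ⟨
    sumFin (λ z → (if exchange M e y z then f z else 0) + point e (f e) z) ≡⟨ sum-cong moved ⟩
    sumFin (λ z → (if M z then f z else 0) + point y (f y) z)   ≡⟨ sum-+-point _ y (f y) ⟩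
    sumFin (λ z → if M z then f z else 0) + f y                 ∎
    where
    open ≡-Reasoning
    moved : ∀ z → (if exchange M e y z then f z else 0) + point e (f e) z
                ≡ (if M z then f z else 0) + point y (f y) z
    moved z with z ≟ e | z ≟ y
    ... | yes refl | yes refl = ⊥-elim (true≢false (trans (sym Me) My))
    ... | yes refl | no _     rewrite Me = sym (+-identityʳ (f z))
    ... | no _     | yes refl rewrite My = +-identityʳ (f z)
    ... | no _     | no _     = refl

  exchange-perfect : ∀ {M e y} → PerfectMatching G M → M e ≡ true → M y ≡ false →
                     (∀ x → mult G y x ≡ mult G e x) → PerfectMatching G (exchange M e y)
  exchange-perfect {M} {e} {y} pm Me My same x =
    +-cancelʳ-≡ (mult G e x) _ 1
      (trans (exchange-sum Me My (λ z → mult G z x)) (cong₂ _+_ (pm x) (same x)))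

  uncoveredBy : EdgeSet G → EdgeSet G → EdgeSet G → EdgeSet G
  uncoveredBy M₁ M₂ M₃ z = not (M₁ z ∨ M₂ z ∨ M₃ z)

  uncovered⇒unmatched : ∀ {M₁ M₂ M₃ y} → uncoveredBy M₁ M₂ M₃ y ≡ true → M₁ y ≡ false
  uncovered⇒unmatched {M₁} {y = y} uy with M₁ y
  ... | false = refl

  exchange-uncovered : ∀ {M₁ M₂ M₃ e y} → M₁ e ≡ true → M₂ e ≡ true → uncoveredBy M₁ M₂ M₃ y ≡ true →
                       uncovered G (exchange M₁ e y) M₂ M₃ + 1 ≡ uncovered G M₁ M₂ M₃
  exchange-uncovered {M₁} {M₂} {M₃} {e} {y} e₁ e₂ uy =
    trans (sym (sum-+-point _ y 1)) (sum-cong moved)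
    where
    indicator : Bool → ℕ
    indicator b = if b then 1 else 0
    moved : ∀ z → indicator (uncoveredBy (exchange M₁ e y) M₂ M₃ z) + point y 1 z
                ≡ indicator (uncoveredBy M₁ M₂ M₃ z)
    moved z with z ≟ e | z ≟ y
    ... | yes refl | yes refl = ⊥-elim (true≢false (trans (sym e₁) (uncovered⇒unmatched {M₁} {M₂} {M₃} uy)))
    ... | yes refl | no _     rewrite e₁ | e₂ = refl
    ... | no _     | yes refl = sym (cong indicator uy)
    ... | no _     | no _     = +-identityʳ _

  matching-unique : ∀ {M e t x} → PerfectMatching G M → M e ≡ true → M t ≡ true → t ≢ e →
                    1 ≤ mult G e x → mult G t x ≡ 0
  matching-unique {M} {e} {t} {x} pm Me Mt t≢e 1≤e = n≤0⇒n≡0 (+-cancelˡ-≤ 1 _ 0 both≤1)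
    where
    selected : ∀ {z} → M z ≡ true → (if M z then mult G z x else 0) ≡ mult G z x
    selected Mz = cong (λ b → if b then _ else 0) Mz
    both≤1 : 1 + mult G t x ≤ 1
    both≤1 = ≤-trans (+-monoˡ-≤ (mult G t x) 1≤e)
               (subst₂ _≤_ (cong₂ _+_ (selected Me) (selected Mt)) (pm x)
                 (sum-two (λ z → if M z then mult G z x else 0) (t≢e ∘ sym)))

  module _ (cubic : Cubic G) (loopless : Loopless) {M₁ M₂ M₃ : EdgeSet G}
           (array : ThreeArray G M₁ M₂ M₃) {e : Edge G}
           (e₁ : M₁ e ≡ true) (e₂ : M₂ e ≡ true) (e₃ : M₃ e ≡ true) where

    uncovered-at-end : ∀ {x} → mult G e x ≡ 1 →
                       2 ≤ sumFin (λ t → if uncoveredBy M₁ M₂ M₃ t then mult G t x else 0)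
    uncovered-at-end {x} e-once = begin
      2                                            ≡⟨ +-cancelˡ-≡ 1 2 _ rest ⟩
      sumFin (erase e (λ t → mult G t x))          ≤⟨ sum-mono only-uncovered ⟩
      sumFin (λ t → if uncoveredBy M₁ M₂ M₃ t then mult G t x else 0) ∎
      where
      open ≤-Reasoning
      rest : 3 ≡ 1 + sumFin (erase e (λ t → mult G t x))
      rest = trans (sym (cubic x))
               (trans (sum-erase (λ t → mult G t x) e) (cong (_+ sumFin (erase e (λ t → mult G t x))) e-once))
      1≤e : 1 ≤ mult G e x
      1≤e = ≤-reflexive (sym e-once)
      only-uncovered : ∀ t → erase e (λ t → mult G t x) t ≤ (if uncoveredBy M₁ M₂ M₃ t then mult G t x else 0)
      only-uncovered t with t ≟ e
      ... | yes _ = z≤n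
      ... | no t≢e with M₁ t in m₁ | M₂ t in m₂ | M₃ t in m₃
      ... | true  | _     | _     = ≤-reflexive (matching-unique (proj₁ array) e₁ m₁ t≢e 1≤e)
      ... | false | true  | _     = ≤-reflexive (matching-unique (proj₁ (proj₂ array)) e₂ m₂ t≢e 1≤e)
      ... | false | false | true  = ≤-reflexive (matching-unique (proj₂ (proj₂ array)) e₃ m₃ t≢e 1≤e)
      ... | false | false | false = ≤-refl

    weight : Edge G → ℕ
    weight t = mult G t (end₁ e) + mult G t (end₂ e)

    uncovered-weight : 4 ≤ sumFin (λ t → if uncoveredBy M₁ M₂ M₃ t then weight t else 0)
    uncovered-weight = subst (4 ≤_) (sym split)
      (+-mono-≤ (uncovered-at-end (proj₁ (nonloop-mult (loopless e))))
                (uncovered-at-end (proj₂ (nonloop-mult (loopless e)))))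
      where
      at : Vertex G → Edge G → ℕ
      at x t = if uncoveredBy M₁ M₂ M₃ t then mult G t x else 0
      if-+ : ∀ b x y → (if b then x + y else 0) ≡ (if b then x else 0) + (if b then y else 0)
      if-+ true  _ _ = refl
      if-+ false _ _ = refl
      split : sumFin (λ t → if uncoveredBy M₁ M₂ M₃ t then weight t else 0)
            ≡ sumFin (at (end₁ e)) + sumFin (at (end₂ e))
      split = trans (sum-cong (λ t → if-+ (uncoveredBy M₁ M₂ M₃ t) (mult G t (end₁ e)) (mult G t (end₂ e))))
                    (sum-+ (at (end₁ e)) (at (end₂ e)))

    triple-reduction : 4 ≤ uncovered G M₁ M₂ M₃ ⊎
                       ∃ λ N → PerfectMatching G N × uncovered G N M₂ M₃ < uncovered G M₁ M₂ M₃
    triple-reduction with any? (λ t → (uncoveredBy M₁ M₂ M₃ t ≟ᵇ true) ×-dec (2 ≤? weight t))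
    ... | no none = inj₁ (≤-trans uncovered-weight (sum-mono light))
      where
      light : ∀ t → (if uncoveredBy M₁ M₂ M₃ t then weight t else 0) ≤ (if uncoveredBy M₁ M₂ M₃ t then 1 else 0)
      light t with uncoveredBy M₁ M₂ M₃ t in ut
      ... | true  = ≤-pred (≰⇒> (λ 2≤w → none (t , ut , 2≤w)))
      ... | false = z≤n
    ... | yes (y , uy , heavy) = inj₂ (exchange M₁ e y , perfect , ≤-reflexive fewer)
      where
      parallel : ∀ x → mult G y x ≡ mult G e x
      parallel = joins-mult (heavy⇒joins (loopless y) (loopless e) heavy) (inj₁ (refl , refl))
      perfect : PerfectMatching G (exchange M₁ e y)
      perfect = exchange-perfect (proj₁ array) e₁ (uncovered⇒unmatched {M₁} {M₂} {M₃} uy) parallel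
      fewer : suc (uncovered G (exchange M₁ e y) M₂ M₃) ≡ uncovered G M₁ M₂ M₃
      fewer = trans (+-comm 1 _) (exchange-uncovered {M₁} {M₂} {M₃} e₁ e₂ uy)

  regular-or-triple : ∀ M₁ M₂ M₃ → Regular G M₁ M₂ M₃ ⊎ ∃ λ e → M₁ e ≡ true × M₂ e ≡ true × M₃ e ≡ true
  regular-or-triple M₁ M₂ M₃
    with any? (λ t → (M₁ t ≟ᵇ true) ×-dec (M₂ t ≟ᵇ true) ×-dec (M₃ t ≟ᵇ true))
  ... | no none   = inj₁ (λ t triple → none (t , triple))
  ... | yes found = inj₂ found

  module _ (cubic : Cubic G) (loopless : Loopless) where

    regular-bound⇒bound : ∀ {k} → k ≤ 4 →
      (∀ M₁ M₂ M₃ → ThreeArray G M₁ M₂ M₃ → Regular G M₁ M₂ M₃ → k ≤ uncovered G M₁ M₂ M₃) →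
      ∀ M₁ M₂ M₃ → ThreeArray G M₁ M₂ M₃ → k ≤ uncovered G M₁ M₂ M₃
    regular-bound⇒bound {k} k≤4 regular-bound M₁ M₂ M₃ array = <-rec P descend _ M₁ array refl
      where
      P : ℕ → Set
      P n = ∀ N → ThreeArray G N M₂ M₃ → uncovered G N M₂ M₃ ≡ n → k ≤ n
      descend : ∀ n → (∀ {m} → m < n → P m) → P n
      descend _ smaller N array′ refl with regular-or-triple N M₂ M₃
      ... | inj₁ regular = regular-bound N M₂ M₃ array′ regular
      ... | inj₂ (e , e₁ , e₂ , e₃) with triple-reduction cubic loopless array′ e₁ e₂ e₃
      ...   | inj₁ many = ≤-trans k≤4 many
      ...   | inj₂ (N′ , perfect , fewer) =
              ≤-trans (smaller fewer N′ (perfect , proj₂ array′) refl) (<⇒≤ fewer)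

    optimal⇒regular : ∀ {M₁ M₂ M₃} → ThreeArray G M₁ M₂ M₃ → uncovered G M₁ M₂ M₃ ≤ 3 →
      (∀ N → PerfectMatching G N → uncovered G M₁ M₂ M₃ ≤ uncovered G N M₂ M₃) →
      Regular G M₁ M₂ M₃
    optimal⇒regular array ≤3 optimal e (e₁ , e₂ , e₃) with triple-reduction cubic loopless array e₁ e₂ e₃
    ... | inj₁ many                  = ≤⇒≯ ≤3 many
    ... | inj₂ (N , perfect , fewer) = <⇒≱ fewer (optimal N perfect)

corollary3p2 : (G : Graph) → Snark G →
    (RegularDefectIs G 3 → DefectIs G 3) × (DefectIs G 3 → RegularDefectIs G 3)
corollary3p2 G snark@(cubic , _) = rdf⇒df , df⇒rdf
  where
  loopless = snark-loopless G snark
  rdf⇒df : RegularDefectIs G 3 → DefectIs G 3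
  rdf⇒df ((M₁ , M₂ , M₃ , array , _ , exactly) , minimal) =
    (M₁ , M₂ , M₃ , array , exactly) , regular-bound⇒bound G cubic loopless (n≤1+n 3) minimal
  df⇒rdf : DefectIs G 3 → RegularDefectIs G 3
  df⇒rdf ((M₁ , M₂ , M₃ , array , exactly) , minimal) =
    (M₁ , M₂ , M₃ , array , regular , exactly) , λ N₁ N₂ N₃ array′ _ → minimal N₁ N₂ N₃ array′
    where
    regular : Regular G M₁ M₂ M₃
    regular = optimal⇒regular G cubic loopless array (≤-reflexive exactly)
                (λ N perfect → subst (_≤ uncovered G N M₂ M₃) (sym exactly)
                                 (minimal N M₂ M₃ (perfect , proj₂ array)))
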